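{- For every $z\in\mathcal{F}_\mathbb{Z}$ one has $\mathcal{F}(\mathcal{I}(z))=z$.
   Context: Let $S_\mathbb{Z}$ be the finitely supported permutations of $\mathbb{Z}$, $\Theta(i)=i-(-1)^i$, $\mathcal{F}_\mathbb{Z}=\{w^{ -1}\Theta w:w\in S_\mathbb{Z}\}$, $\mathcal{I}_\mathbb{Z}=\{w\in S_\mathbb{Z}: w=w^{ -1}\}$. For $z\in\mathcal{F}_\mathbb{Z}$ let $\mathrm{Cyc}_\mathbb{Z}(z)=\{(i,j):i<j=z(i)\}$ and let $\mathcal{I}(z)\in\mathcal{I}_\mathbb{Z}$ be the involution whose nontrivial cycles are exactly the $(p,q)\in\mathrm{Cyc}_\mathbb{Z}(z)$ for which some $(a,b)\in\mathrm{Cyc}_\mathbb{Z}(z)$ satisfies $p<b<q$. For $y\in\mathcal{I}_\mathbb{Z}$, let $m$ be an even integer less than every element of $\mathrm{supp}(y)$, $\rho:\mathbb{Z}\to\mathbb{Z}\setminus\mathrm{supp}(y)$ the order-preserving bijection with $\rho(0)=m$, and $\mathcal{F}(y)$ the unique element of $\mathcal{F}_\mathbb{Z}$ with $\mathcal{F}(y)(i)=y(i)$ for $i\in\mathrm{supp}(y)$ and $\mathcal{F}(y)\circ\rho=\rho\circ\Theta$. -}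

module Defs where

open import Data.Nat as ℕ using (ℕ)
open import Data.Nat.DivMod using (_%_)
open import Data.Integer as ℤ using (ℤ; +_; _<_; _-_; ∣_∣)
open import Data.Integer.Divisibility using (_∣_)
open import Data.Bool using (if_then_else_)
open import Data.Product using (Σ; ∃; _×_; _,_)
open import Relation.Binary.PropositionalEquality using (_≡_; _≢_)
open import Relation.Nullary using (¬_)
open import Function using (_⇔_)

-- (-1)^i for i ∈ ℤ  (parity of i = parity of |i|)
negOnePow : ℤ → ℤ
negOnePow i = if (∣ i ∣ % 2) ℕ.≡ᵇ 0 then + 1 else ℤ.- (+ 1)

Θ : ℤ → ℤ
Θ i = i - negOnePow i

record FinPerm : Set where
  field
    to       : ℤ → ℤ
    from     : ℤ → ℤ
    from-to  : ∀ i → from (to i) ≡ i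
    to-from  : ∀ i → to (from i) ≡ i
    bound    : ℕ
    finite   : ∀ i → bound ℕ.< ∣ i ∣ → to i ≡ i

open FinPerm public

InF : (ℤ → ℤ) → Set
InF z = Σ FinPerm λ w → ∀ i → z i ≡ from w (Θ (to w i))

InI : (ℤ → ℤ) → Set
InI y = (Σ FinPerm λ w → ∀ i → to w i ≡ y i) × (∀ i → y (y i) ≡ i)

InCyc : (ℤ → ℤ) → ℤ → ℤ → Set
InCyc z i j = i < j × z i ≡ j

IsI : (ℤ → ℤ) → (ℤ → ℤ) → Set
IsI z y = InI y ×
  (∀ p q → InCyc y p q ⇔
     (InCyc z p q × ∃ λ a → ∃ λ b → InCyc z a b × p < b × b < q))

IsRho : (ℤ → ℤ) → ℤ → (ℤ → ℤ) → Set
IsRho y m ρ =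
  (∀ i j → i < j → ρ i < ρ j) ×
  (∀ i → y (ρ i) ≡ ρ i) ×
  (∀ j → y j ≡ j → ∃ λ i → ρ i ≡ j) ×
  ρ (+ 0) ≡ m

IsM : (ℤ → ℤ) → ℤ → Set
IsM y m = (+ 2) ∣ m × (∀ i → y i ≢ i → m < i)

-- f satisfies the defining property of F(y) (w.r.t. the choice m, ρ):
-- f(i) = y(i) on supp(y), and f ∘ ρ = ρ ∘ Θ
FProp : (ℤ → ℤ) → (ℤ → ℤ) → (ℤ → ℤ) → Set
FProp y ρ f = (∀ i → y i ≢ i → f i ≡ y i) × (∀ i → f (ρ i) ≡ ρ (Θ i))

-- The fixed points of y = I(z) are closed under z, and an arc (j, z j) of z starting at a
-- fixed point of y encloses no endpoint of another arc (else it would be a cycle of y), hence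
-- no other fixed point of y. Relabelled by ρ, z therefore pairs each ρ i with ρ (i ± 1).
-- A perfect matching of ℤ into neighbouring pairs is Θ or its shift, and a single Θ-pair
-- decides which: far to the left ρ is translation by the even number m and z = Θ, so it is Θ.
-- On the support of y, z agrees with y by the definition of I(z).
module Submission where

open import Defs
open import Data.Bool using (Bool; true; false; not; if_then_else_)
open import Data.Empty using (⊥; ⊥-elim)
open import Data.Integer
  using (ℤ; +_; -[1+_]; -_; _-_; _<_; _≤_; ∣_∣; pred; -≤+; -≤-; _⊖_)
  renaming (suc to sucℤ)
import Data.Integer.Properties as ℤ
open import Data.Integer.Divisibility using (_∣_; divides)
open import Data.Nat as ℕ using (ℕ; zero; suc)
import Data.Nat.Properties as ℕ
open import Data.Nat.DivMod using (_%_; m*n%n≡0)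
open import Data.Product using (∃; _,_; proj₁; proj₂)
open import Data.Sum using (_⊎_; inj₁; inj₂)
open import Function using (Equivalence; _∘′_)
open import Relation.Binary.Definitions using (tri<; tri≈; tri>)
open import Relation.Binary.PropositionalEquality
open import Relation.Nullary using (yes; no)

private
  ±1 : Bool → ℤ
  ±1 b = if b then + 1 else - + 1

  isEven : ℕ → Bool
  isEven n = (n % 2) ℕ.≡ᵇ 0

  isEven-suc : ∀ n → isEven (suc n) ≡ not (isEven n)
  isEven-suc zero          = refl
  isEven-suc (suc zero)    = refl
  isEven-suc (suc (suc n)) = isEven-suc n

  ±1-not : ∀ b → ±1 (not b) ≡ - ±1 b
  ±1-not true  = refl
  ±1-not false = refl

negOnePow-suc : ∀ i → negOnePow (sucℤ i) ≡ - negOnePow i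
negOnePow-suc (+ n)          = trans (cong ±1 (isEven-suc n)) (±1-not (isEven n))
negOnePow-suc -[1+ zero ]    = refl
negOnePow-suc -[1+ suc n ]   =
  sym (trans (cong -_ (negOnePow-suc (+ suc n))) (ℤ.neg-involutive _))

negOnePow-pred : ∀ i → negOnePow (pred i) ≡ - negOnePow i
negOnePow-pred i = begin
  negOnePow (pred i)                ≡⟨ ℤ.neg-involutive _ ⟨
  - - negOnePow (pred i)            ≡⟨ cong -_ (negOnePow-suc (pred i)) ⟨
  - negOnePow (sucℤ (pred i))       ≡⟨ cong (-_ ∘′ negOnePow) (ℤ.suc-pred i) ⟩
  - negOnePow i                     ∎
  where open ≡-Reasoning

negOnePow-cases : ∀ i → negOnePow i ≡ + 1 ⊎ negOnePow i ≡ - + 1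
negOnePow-cases i with isEven ∣ i ∣
... | true  = inj₁ refl
... | false = inj₂ refl

negOnePow-even : ∀ i → + 2 ∣ i → negOnePow i ≡ + 1
negOnePow-even i (divides q ∣i∣≡q*2) rewrite ∣i∣≡q*2 | m*n%n≡0 q 2 {{_}} = refl

negOnePow-minus-even : ∀ a t → negOnePow (a - + (t ℕ.* 2)) ≡ negOnePow a
negOnePow-minus-even a zero    = cong negOnePow (ℤ.+-identityʳ a)
negOnePow-minus-even a (suc t) = begin
  negOnePow (a - + suc (suc (t ℕ.* 2)))    ≡⟨ cong negOnePow (ℤ.minus-suc a (suc (t ℕ.* 2))) ⟩
  negOnePow (pred (a - + suc (t ℕ.* 2)))   ≡⟨ negOnePow-pred (a - + suc (t ℕ.* 2)) ⟩
  - negOnePow (a - + suc (t ℕ.* 2))        ≡⟨ cong (-_ ∘′ negOnePow) (ℤ.minus-suc a (t ℕ.* 2)) ⟩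
  - negOnePow (pred (a - + (t ℕ.* 2)))     ≡⟨ cong -_ (negOnePow-pred (a - + (t ℕ.* 2))) ⟩
  - - negOnePow (a - + (t ℕ.* 2))          ≡⟨ ℤ.neg-involutive _ ⟩
  negOnePow (a - + (t ℕ.* 2))              ≡⟨ negOnePow-minus-even a t ⟩
  negOnePow a                              ∎
  where open ≡-Reasoning

Θ-even : ∀ i → negOnePow i ≡ + 1 → Θ i ≡ pred i
Θ-even i e rewrite e = ℤ.+-comm i (- + 1)

Θ-odd : ∀ i → negOnePow i ≡ - + 1 → Θ i ≡ sucℤ i
Θ-odd i e rewrite e = ℤ.+-comm i (+ 1)

Θ-involutive : ∀ i → Θ (Θ i) ≡ i
Θ-involutive i with negOnePow-cases i
... | inj₁ e = begin
  Θ (Θ i)          ≡⟨ cong Θ (Θ-even i e) ⟩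
  Θ (pred i)       ≡⟨ Θ-odd (pred i) (trans (negOnePow-pred i) (cong -_ e)) ⟩
  sucℤ (pred i)    ≡⟨ ℤ.suc-pred i ⟩
  i                ∎
  where open ≡-Reasoning
... | inj₂ e = begin
  Θ (Θ i)          ≡⟨ cong Θ (Θ-odd i e) ⟩
  Θ (sucℤ i)       ≡⟨ Θ-even (sucℤ i) (trans (negOnePow-suc i) (cong -_ e)) ⟩
  pred (sucℤ i)    ≡⟨ ℤ.pred-suc i ⟩
  i                ∎
  where open ≡-Reasoning

pred<i : ∀ i → pred i < i
pred<i i = ℤ.i≤pred[j]⇒i<j ℤ.≤-refl

i<suc : ∀ i → i < sucℤ i
i<suc i = ℤ.suc[i]≤j⇒i<j ℤ.≤-refl

Θ-fixedPointFree : ∀ i → Θ i ≢ i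
Θ-fixedPointFree i Θi≡i with negOnePow-cases i
... | inj₁ e = ℤ.<-irrefl (trans (sym (Θ-even i e)) Θi≡i) (pred<i i)
... | inj₂ e = ℤ.<-irrefl (trans (sym Θi≡i) (Θ-odd i e)) (i<suc i)

i≤+∣i∣ : ∀ i → i ≤ + ∣ i ∣
i≤+∣i∣ (+ n)     = ℤ.≤-refl
i≤+∣i∣ -[1+ n ]  = -≤+

i-n≤-[1+B] : ∀ i B {n} → ∣ i ∣ ℕ.+ suc B ℕ.≤ n → i - + n ≤ -[1+ B ]
i-n≤-[1+B] i B {n} large = begin
  i - + n                           ≤⟨ ℤ.+-monoˡ-≤ (- + n) (i≤+∣i∣ i) ⟩
  + ∣ i ∣ - + n                     ≡⟨ ℤ.[+m]-[+n]≡m⊖n ∣ i ∣ n ⟩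
  ∣ i ∣ ⊖ n                         ≤⟨ ℤ.⊖-monoʳ-≥-≤ ∣ i ∣ large ⟩
  ∣ i ∣ ⊖ (∣ i ∣ ℕ.+ suc B)         ≡⟨ cong (_⊖ (∣ i ∣ ℕ.+ suc B)) (ℕ.+-identityʳ ∣ i ∣) ⟨
  (∣ i ∣ ℕ.+ 0) ⊖ (∣ i ∣ ℕ.+ suc B) ≡⟨ ℤ.+-cancelˡ-⊖ ∣ i ∣ 0 (suc B) ⟩
  -[1+ B ]                          ∎
  where open ℤ.≤-Reasoning

≤-[1+B]⇒B<∣i∣ : ∀ {i B} → i ≤ -[1+ B ] → B ℕ.< ∣ i ∣
≤-[1+B]⇒B<∣i∣ (-≤- B≤n) = ℕ.s≤s B≤n

ℤ-propagate : ∀ {ℓ} (P : ℤ → Set ℓ) →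
  (∀ i → P i → P (sucℤ i)) → (∀ i → P (sucℤ i) → P i) →
  ∀ {k} → P k → ∀ i → P i
ℤ-propagate P up down {k} Pk = from0 (to0 k Pk)
  where
  to0 : ∀ k → P k → P (+ 0)
  to0 (+ zero)           P0 = P0
  to0 (+ suc n)          Pk = to0 (+ n) (down (+ n) Pk)
  to0 -[1+ zero ]        Pk = up -[1+ zero ] Pk
  to0 -[1+ suc n ]       Pk = to0 -[1+ n ] (up -[1+ suc n ] Pk)

  from0 : P (+ 0) → ∀ i → P i
  from0 P0 (+ zero)      = P0
  from0 P0 (+ suc n)     = up (+ n) (from0 P0 (+ n))
  from0 P0 -[1+ zero ]   = down -[1+ zero ] P0
  from0 P0 -[1+ suc n ]  = down -[1+ suc n ] (from0 P0 -[1+ n ])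

data ΘParity (i : ℤ) : Set where
  even : Θ i ≡ pred i → Θ (sucℤ i) ≡ sucℤ (sucℤ i) → ΘParity i
  odd  : Θ i ≡ sucℤ i → Θ (sucℤ i) ≡ i → ΘParity i

Θ-parity : ∀ i → ΘParity i
Θ-parity i with negOnePow-cases i
... | inj₁ e = even (Θ-even i e) (Θ-odd (sucℤ i) (trans (negOnePow-suc i) (cong -_ e)))
... | inj₂ e = odd (Θ-odd i e)
  (trans (Θ-even (sucℤ i) (trans (negOnePow-suc i) (cong -_ e))) (ℤ.pred-suc i))

module AdjacentMatching {ℓ} (M : ℤ → ℤ → Set ℓ)
  (M-sym : ∀ {i j} → M i j → M j i)
  (M-functional : ∀ {i j k} → M i j → M i k → j ≡ k)
  (M-adjacent : ∀ i → M i (sucℤ i) ⊎ M i (pred i)) where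

  step-up : ∀ i → M i (Θ i) → M (sucℤ i) (Θ (sucℤ i))
  step-up i h with Θ-parity i
  ... | odd Θi Θsi = subst (M (sucℤ i)) (sym Θsi) (M-sym (subst (M i) Θi h))
  ... | even Θi Θsi with M-adjacent (sucℤ i)
  ...   | inj₁ h′ = subst (M (sucℤ i)) (sym Θsi) h′
  ...   | inj₂ h′ = ⊥-elim (ℤ.<-irrefl pred≡suc (ℤ.<-trans (pred<i i) (i<suc i)))
    where
    pred≡suc : pred i ≡ sucℤ i
    pred≡suc = M-functional (subst (M i) Θi h)
                 (M-sym (subst (M (sucℤ i)) (ℤ.pred-suc i) h′))

  step-down : ∀ i → M (sucℤ i) (Θ (sucℤ i)) → M i (Θ i)
  step-down i h with Θ-parity i
  ... | odd Θi Θsi = subst (M i) (sym Θi) (M-sym (subst (M (sucℤ i)) Θsi h))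
  ... | even Θi Θsi with M-adjacent i
  ...   | inj₂ h′ = subst (M i) (sym Θi) h′
  ...   | inj₁ h′ = ⊥-elim (ℤ.<-irrefl i≡sucsuc (ℤ.<-trans (i<suc i) (i<suc (sucℤ i))))
    where
    i≡sucsuc : i ≡ sucℤ (sucℤ i)
    i≡sucsuc = M-functional (M-sym h′) (subst (M (sucℤ i)) Θsi h)

  along-Θ : ∀ {k} → M k (Θ k) → ∀ i → M i (Θ i)
  along-Θ = ℤ-propagate (λ i → M i (Θ i)) step-up step-down

module StrictlyMonotone (f : ℤ → ℤ) (f-mono : ∀ i j → i < j → f i < f j) where

  reflects-< : ∀ {i j} → f i < f j → i < j
  reflects-< {i} {j} fi<fj with ℤ.<-cmp i j
  ... | tri< i<j _ _ = i<j
  ... | tri≈ _ refl _ = ⊥-elim (ℤ.<-irrefl refl fi<fj)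
  ... | tri> _ _ j<i = ⊥-elim (ℤ.<-asym fi<fj (f-mono j i j<i))

  injective : ∀ {i j} → f i ≡ f j → i ≡ j
  injective {i} {j} fi≡fj with ℤ.<-cmp i j
  ... | tri< i<j _ _ = ⊥-elim (ℤ.<-irrefl fi≡fj (f-mono i j i<j))
  ... | tri≈ _ i≡j _ = i≡j
  ... | tri> _ _ j<i = ⊥-elim (ℤ.<-irrefl (sym fi≡fj) (f-mono j i j<i))

  no-value-between⇒suc : ∀ {i j} → i < j →
    (∀ r → f i < f r → f r < f j → ⊥) → j ≡ sucℤ i
  no-value-between⇒suc {i} {j} i<j gap = ℤ.≤-antisym j≤suc (ℤ.i<j⇒suc[i]≤j i<j)
    where
    j≤suc : j ≤ sucℤ i
    j≤suc = ℤ.≮⇒≥ λ suc<j →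
      gap (sucℤ i) (f-mono i (sucℤ i) (i<suc i)) (f-mono (sucℤ i) j suc<j)

module Conjugate (w : FinPerm) {f z : ℤ → ℤ}
  (z≗ : ∀ i → z i ≡ from w (f (to w i))) where

  involutive : (∀ i → f (f i) ≡ i) → ∀ i → z (z i) ≡ i
  involutive f-inv i = begin
    z (z i)                                 ≡⟨ z≗ (z i) ⟩
    from w (f (to w (z i)))                 ≡⟨ cong (from w ∘′ f ∘′ to w) (z≗ i) ⟩
    from w (f (to w (from w (f (to w i))))) ≡⟨ cong (from w ∘′ f) (to-from w _) ⟩
    from w (f (f (to w i)))                 ≡⟨ cong (from w) (f-inv _) ⟩
    from w (to w i)                         ≡⟨ from-to w i ⟩
    i                                       ∎
    where open ≡-Reasoning

  fixedPointFree : (∀ i → f i ≢ i) → ∀ i → z i ≢ i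
  fixedPointFree f-fpf i zi≡i = f-fpf (to w i) (begin
    f (to w i)                    ≡⟨ to-from w _ ⟨
    to w (from w (f (to w i)))    ≡⟨ cong (to w) (z≗ i) ⟨
    to w (z i)                    ≡⟨ cong (to w) zi≡i ⟩
    to w i                        ∎)
    where open ≡-Reasoning

  agrees-outside-bound : ∀ i → bound w ℕ.< ∣ i ∣ → bound w ℕ.< ∣ f i ∣ → z i ≡ f i
  agrees-outside-bound i i-far fi-far = begin
    z i                       ≡⟨ z≗ i ⟩
    from w (f (to w i))       ≡⟨ cong (from w ∘′ f) (finite w i i-far) ⟩
    from w (f i)              ≡⟨ cong (from w) (finite w (f i) fi-far) ⟨
    from w (to w (f i))       ≡⟨ from-to w (f i) ⟩
    f i                       ∎
    where open ≡-Reasoning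

module NestedArcs {z : ℤ → ℤ} (z-inv : ∀ i → z (z i) ≡ i) (z-fpf : ∀ i → z i ≢ i)
  {y : ℤ → ℤ} (y-isI : IsI z y) where

  private
    y-inv : ∀ i → y (y i) ≡ i
    y-inv = proj₂ (proj₁ y-isI)

    module Cyc p q = Equivalence (proj₂ y-isI p q)

  y-arc⇒z : ∀ {p q} → p < q → y p ≡ q → z p ≡ q
  y-arc⇒z {p} {q} p<q ypq = proj₂ (proj₁ (Cyc.to p q (p<q , ypq)))

  agrees-on-support : ∀ i → y i ≢ i → z i ≡ y i
  agrees-on-support i yi≢i with ℤ.<-cmp i (y i)
  ... | tri< i<yi _ _ = y-arc⇒z i<yi refl
  ... | tri≈ _ i≡yi _ = ⊥-elim (yi≢i (sym i≡yi))
  ... | tri> _ _ yi<i = begin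
    z i            ≡⟨ cong z (y-arc⇒z yi<i (y-inv i)) ⟨
    z (z (y i))    ≡⟨ z-inv (y i) ⟩
    y i            ∎
    where open ≡-Reasoning

  nested⇒y-arc : ∀ {p a b} → p < z p → InCyc z a b → p < b → b < z p → y p ≡ z p
  nested⇒y-arc {p} {a} {b} p<zp ab p<b b<zp =
    proj₂ (Cyc.from p (z p) ((p<zp , refl) , a , b , ab , p<b , b<zp))

  fixed⇒z-fixed : ∀ j → y j ≡ j → y (z j) ≡ z j
  fixed⇒z-fixed j yj≡j with y (z j) ℤ.≟ z j
  ... | yes yzj≡zj = yzj≡zj
  ... | no  yzj≢zj = ⊥-elim (z-fpf j (sym (begin
    j              ≡⟨ yj≡j ⟨
    y j            ≡⟨ cong y (z-inv j) ⟨
    y (z (z j))    ≡⟨ cong y (agrees-on-support (z j) yzj≢zj) ⟩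
    y (y (z j))    ≡⟨ y-inv (z j) ⟩
    z j            ∎)))
    where open ≡-Reasoning

  fixed-arc-unnested : ∀ {j a b} → y j ≡ j → j < z j →
    InCyc z a b → j < b → b < z j → ⊥
  fixed-arc-unnested {j} yj≡j j<zj ab j<b b<zj =
    ℤ.<-irrefl (trans (sym yj≡j) (nested⇒y-arc j<zj ab j<b b<zj)) j<zj

  no-fixed-under-arc : ∀ {j r} → y j ≡ j → j < z j → y r ≡ r → j < r → r < z j → ⊥
  -- The arc through r either has an endpoint inside (j, z j) or encloses z j.
  no-fixed-under-arc {j} {r} yj≡j j<zj yr≡r j<r r<zj with ℤ.<-cmp r (z r)
  ... | tri≈ _ r≡zr _ = z-fpf r (sym r≡zr)
  ... | tri> _ _ zr<r = fixed-arc-unnested yj≡j j<zj (zr<r , z-inv r) j<r r<zj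
  ... | tri< r<zr _ _ with ℤ.<-cmp (z r) (z j)
  ...   | tri< zr<zj _ _ =
    fixed-arc-unnested yj≡j j<zj (r<zr , refl) (ℤ.<-trans j<r r<zr) zr<zj
  ...   | tri≈ _ zr≡zj _ =
    ℤ.<-irrefl (trans (sym (z-inv j)) (trans (cong z (sym zr≡zj)) (z-inv r))) j<r
  ...   | tri> _ _ zj<zr =
    z-fpf r (sym (trans (sym yr≡r) (nested⇒y-arc r<zr (j<zj , refl) r<zj zj<zr)))

module Relabelling {z : ℤ → ℤ} (z-inv : ∀ i → z (z i) ≡ i) (z-fpf : ∀ i → z i ≢ i)
  {y : ℤ → ℤ} (y-isI : IsI z y) {m : ℤ} (m-isM : IsM y m)
  {ρ : ℤ → ℤ} (ρ-isRho : IsRho y m ρ) where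

  open NestedArcs z-inv z-fpf y-isI

  private
    ρ-mono : ∀ i j → i < j → ρ i < ρ j
    ρ-mono = proj₁ ρ-isRho

    ρ-fixed : ∀ i → y (ρ i) ≡ ρ i
    ρ-fixed = proj₁ (proj₂ ρ-isRho)

    ρ-onto : ∀ j → y j ≡ j → ∃ λ i → ρ i ≡ j
    ρ-onto = proj₁ (proj₂ (proj₂ ρ-isRho))

    ρ0≡m : ρ (+ 0) ≡ m
    ρ0≡m = proj₂ (proj₂ (proj₂ ρ-isRho))

  open StrictlyMonotone ρ ρ-mono

  fixed-below : ∀ v → v ≤ m → y v ≡ v
  fixed-below v v≤m with y v ℤ.≟ v
  ... | yes yv≡v = yv≡v
  ... | no  yv≢v = ⊥-elim (ℤ.<-irrefl refl (ℤ.<-≤-trans (proj₂ m-isM v yv≢v) v≤m))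

  ρ-pred : ∀ i → ρ i ≤ m → ρ (pred i) ≡ pred (ρ i)
  ρ-pred i ρi≤m with ρ-onto (pred (ρ i)) (fixed-below _ (ℤ.i≤j⇒pred[i]≤j ρi≤m))
  ... | c , ρc≡ = begin
    ρ (pred i)            ≡⟨ cong (ρ ∘′ pred) i≡suc[c] ⟩
    ρ (pred (sucℤ c))     ≡⟨ cong ρ (ℤ.pred-suc c) ⟩
    ρ c                   ≡⟨ ρc≡ ⟩
    pred (ρ i)            ∎
    where
    open ≡-Reasoning
    ρc<ρi : ρ c < ρ i
    ρc<ρi = subst (_< ρ i) (sym ρc≡) (pred<i (ρ i))
    i≡suc[c] : i ≡ sucℤ c
    i≡suc[c] = no-value-between⇒suc (reflects-< ρc<ρi) λ r ρc<ρr ρr<ρi →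
      ℤ.<-irrefl refl (ℤ.≤-<-trans
        (subst (_≤ ρ r) (ℤ.suc-pred (ρ i)) (ℤ.i<j⇒suc[i]≤j (subst (_< ρ r) ρc≡ ρc<ρr)))
        ρr<ρi)

  ρ-nonpositive : ∀ n → ρ (- + n) ≡ m - + n
  ρ-nonpositive zero    = trans ρ0≡m (sym (ℤ.+-identityʳ m))
  ρ-nonpositive (suc n) = begin
    ρ -[1+ n ]          ≡⟨ cong ρ (ℤ.neg-suc n) ⟩
    ρ (pred (- + n))    ≡⟨ ρ-pred (- + n) (subst (_≤ m) (sym (ρ-nonpositive n)) (ℤ.i-j≤i m (+ n))) ⟩
    pred (ρ (- + n))    ≡⟨ cong pred (ρ-nonpositive n) ⟩
    pred (m - + n)      ≡⟨ ℤ.minus-suc m n ⟨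
    m - + suc n         ∎
    where open ≡-Reasoning

  arc-adjacent : ∀ {a b} → a < b → z (ρ a) ≡ ρ b → b ≡ sucℤ a
  arc-adjacent {a} {b} a<b zρa≡ρb = no-value-between⇒suc a<b λ r ρa<ρr ρr<ρb →
    no-fixed-under-arc (ρ-fixed a) (subst (ρ a <_) (sym zρa≡ρb) (ρ-mono a b a<b))
      (ρ-fixed r) ρa<ρr (subst (ρ r <_) (sym zρa≡ρb) ρr<ρb)

  -- The graph of ρ⁻¹ ∘ z ∘ ρ, without inverting ρ.
  Matched : ℤ → ℤ → Set
  Matched i j = z (ρ i) ≡ ρ j

  matched-sym : ∀ {i j} → Matched i j → Matched j i
  matched-sym {i} h = trans (cong z (sym h)) (z-inv (ρ i))

  matched-functional : ∀ {i j k} → Matched i j → Matched i k → j ≡ k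
  matched-functional h h′ = injective (trans (sym h) h′)

  matched-adjacent : ∀ i → Matched i (sucℤ i) ⊎ Matched i (pred i)
  matched-adjacent i with ρ-onto (z (ρ i)) (fixed⇒z-fixed (ρ i) (ρ-fixed i))
  ... | s , ρs≡zρi with ℤ.<-cmp i s
  ...   | tri≈ _ i≡s _ = ⊥-elim (z-fpf (ρ i) (trans (sym ρs≡zρi) (cong ρ (sym i≡s))))
  ...   | tri< i<s _ _ = inj₁ (trans (sym ρs≡zρi) (cong ρ (arc-adjacent i<s (sym ρs≡zρi))))
  ...   | tri> _ _ s<i = inj₂ (trans (sym ρs≡zρi) (cong ρ s≡pred[i]))
    where
    s≡pred[i] : s ≡ pred i
    s≡pred[i] = trans (sym (ℤ.pred-suc s))
      (cong pred (sym (arc-adjacent s<i (matched-sym (sym ρs≡zρi)))))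

  open AdjacentMatching Matched matched-sym matched-functional matched-adjacent public

  -- Left of m every point is fixed by y, so ρ (- n) = m - n; take n even and large.
  along-Θ-somewhere : ∀ B → (∀ i → B ℕ.< ∣ i ∣ → B ℕ.< ∣ Θ i ∣ → z i ≡ Θ i) →
    ∃ λ k → Matched k (Θ k)
  along-Θ-somewhere B z≡Θ-far = k , (begin
    z (ρ k)          ≡⟨ cong z (ρ-nonpositive n) ⟩
    z x              ≡⟨ z≡Θ-far x (≤-[1+B]⇒B<∣i∣ x-far) (≤-[1+B]⇒B<∣i∣ Θx-far) ⟩
    Θ x              ≡⟨ Θ-even x x-even ⟩
    pred x           ≡⟨ ℤ.minus-suc m n ⟨
    m - + suc n      ≡⟨ ρ-nonpositive (suc n) ⟨
    ρ -[1+ n ]       ≡⟨ cong ρ (ℤ.neg-suc n) ⟩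
    ρ (pred k)       ≡⟨ cong ρ (Θ-even k k-even) ⟨
    ρ (Θ k)          ∎)
    where
    open ≡-Reasoning
    t n : ℕ
    t = ∣ m ∣ ℕ.+ suc B
    n = t ℕ.* 2
    k x : ℤ
    k = - + n
    x = m - + n
    x-even : negOnePow x ≡ + 1
    x-even = trans (negOnePow-minus-even m t) (negOnePow-even m (proj₁ m-isM))
    k-even : negOnePow k ≡ + 1
    k-even = trans (cong negOnePow (sym (ℤ.+-identityˡ k))) (negOnePow-minus-even (+ 0) t)
    x-far : x ≤ -[1+ B ]
    x-far = i-n≤-[1+B] m B (ℕ.m≤m*n t 2)
    Θx-far : Θ x ≤ -[1+ B ]
    Θx-far = subst (_≤ -[1+ B ]) (sym (Θ-even x x-even)) (ℤ.i≤j⇒pred[i]≤j x-far)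

proposition3p15 : (z : ℤ → ℤ) → InF z → (y : ℤ → ℤ) → IsI z y →
    (m : ℤ) → IsM y m → (ρ : ℤ → ℤ) → IsRho y m ρ → FProp y ρ z
proposition3p15 z (w , z≗) y y-isI m m-isM ρ ρ-isRho =
  agrees-on-support , along-Θ (proj₂ (along-Θ-somewhere (bound w) agrees-outside-bound))
  where
  open Conjugate w {f = Θ} z≗

  z-inv : ∀ i → z (z i) ≡ i
  z-inv = involutive Θ-involutive

  z-fpf : ∀ i → z i ≢ i
  z-fpf = fixedPointFree Θ-fixedPointFree

  open NestedArcs z-inv z-fpf y-isI using (agrees-on-support)
  open Relabelling z-inv z-fpf y-isI m-isM ρ-isRho using (along-Θ-somewhere; along-Θ)
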